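{- Let $V=(v_{ij})\in\mathbb{R}^{n\times d}$. The linear program $$\text{minimize}_{\pi\ge 0,\ \phi\ge 0}\ \sum_{i=1}^n\sum_{j=1}^d v_{ij}\pi_{ij}-\sum_{i=1}^n\sum_{j=1}^d v_{ij}\phi_{ji}$$ subject to $\sum_{i=1}^n(\pi_{ij}-\phi_{ji})=0$ for $1\le j\le d$, $\sum_{j=1}^d\pi_{ij}=1$ for $1\le i\le n$, and $\sum_{j=1}^d\phi_{ji}=1$ for $1\le i\le n$ (the dual of the tropical Fermat-Weber linear program) has an optimal solution with all entries $\pi_{ij},\phi_{ji}\in\{0,1\}$.
   Context: This program is the LP dual of the tropical Fermat-Weber linear program: maximize $-\sum_i y_i+\sum_i z_i$ over $x\in\mathbb{R}^d$, $y,z\in\mathbb{R}^n$ subject to $x_j-y_i\le v_{ij}$ and $z_i-x_j\le -v_{ij}$ for all $i\in[n]$, $j\in[d]$, whose optimal $x$ are the minimizers of $\sum_i d_{\mathrm{tr}}(x,v_i)$ with $d_{\mathrm{tr}}(u,v)=\max_j(u_j-v_j)-\min_k(u_k-v_k)$. -}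

module Defs where

open import Level using (Level; _⊔_) renaming (suc to lsuc)
open import Data.Nat using (ℕ; zero; suc)
open import Data.Fin using (Fin; zero; suc)
open import Data.Product using (_×_; ∃)
open import Data.Sum using (_⊎_)
open import Relation.Nullary using (¬_)
open import Relation.Binary.Core using (Rel)
open import Relation.Binary.Structures using (IsTotalOrder)
open import Algebra.Core using (Op₁; Op₂)
open import Algebra.Structures using (IsCommutativeRing)

-- An ordered field (the real numbers are one; no completeness is needed
-- for this purely algebraic LP statement).
record OrderedField (c ℓ₁ ℓ₂ : Level) : Set (lsuc (c ⊔ ℓ₁ ⊔ ℓ₂)) where
  infix  4 _≈_ _≤_
  infixl 6 _+_ _-_
  infixl 7 _*_
  infix  8 -_
  field
    Carrier : Set c
    _≈_     : Rel Carrier ℓ₁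
    _≤_     : Rel Carrier ℓ₂
    _+_     : Op₂ Carrier
    _*_     : Op₂ Carrier
    -_      : Op₁ Carrier
    0#      : Carrier
    1#      : Carrier
    isCommutativeRing : IsCommutativeRing _≈_ _+_ _*_ -_ 0# 1#
    isTotalOrder      : IsTotalOrder _≈_ _≤_
    +-monoˡ-≤         : ∀ {x y} z → x ≤ y → x + z ≤ y + z
    *-nonneg          : ∀ {x y} → 0# ≤ x → 0# ≤ y → 0# ≤ x * y
    0≉1               : ¬ (0# ≈ 1#)
    inverse           : ∀ x → ¬ (x ≈ 0#) → ∃ λ y → x * y ≈ 1#

  _-_ : Op₂ Carrier
  x - y = x + (- y)

  Σ : ∀ m → (Fin m → Carrier) → Carrier
  Σ zero    f = 0#
  Σ (suc m) f = f zero + Σ m (λ k → f (suc k))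

module DualLP {c ℓ₁ ℓ₂} (F : OrderedField c ℓ₁ ℓ₂) (n d : ℕ)
              (v : Fin n → Fin d → OrderedField.Carrier F) where
  open OrderedField F

  objective : (Fin n → Fin d → Carrier) → (Fin d → Fin n → Carrier) → Carrier
  objective π φ =
    Σ n (λ i → Σ d (λ j → v i j * π i j)) - Σ n (λ i → Σ d (λ j → v i j * φ j i))

  Feasible : (Fin n → Fin d → Carrier) → (Fin d → Fin n → Carrier) → Set (ℓ₁ ⊔ ℓ₂)
  Feasible π φ =
    (∀ i j → 0# ≤ π i j) ×
    (∀ j i → 0# ≤ φ j i) ×
    (∀ j → Σ n (λ i → π i j - φ j i) ≈ 0#) ×
    (∀ i → Σ d (λ j → π i j) ≈ 1#) ×
    (∀ i → Σ d (λ j → φ j i) ≈ 1#)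

  Optimal : (Fin n → Fin d → Carrier) → (Fin d → Fin n → Carrier) → Set (c ⊔ ℓ₁ ⊔ ℓ₂)
  Optimal π φ =
    Feasible π φ ×
    (∀ π′ φ′ → Feasible π′ φ′ → objective π φ ≤ objective π′ φ′)

  ZeroOne : ∀ {a b} → (Fin a → Fin b → Carrier) → Set ℓ₁
  ZeroOne M = ∀ p q → (M p q ≈ 0#) ⊎ (M p q ≈ 1#)

-- A 0/1 feasible point is a pair of maps a, b : [n] → [d] (π_{i,a i} = φ_{b i,i} = 1) with
-- equal column counts; we call such a pair balanced. Its objective is Σ_i v_{i,a i} − Σ_i v_{i,b i}.
-- Take a balanced pair of least cost (there are finitely many). Moving a i from m to k, or b i from
-- k to m, is an edge m → k of an exchange graph on [d] and changes the cost by v_ik − v_im. Applying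
-- a cycle that moves no entry twice gives another balanced pair, so such cycles have nonnegative
-- weight; every closed walk splits into such cycles, so the graph has no negative cycle.
-- Fourier–Motzkin elimination of its vertices then yields a potential x with x_k ≤ x_m + w on every
-- edge, i.e. in each row i the reduced cost v_ij − x_j is least at a i and largest at b i. Shifting
-- v by x does not change the objective on the feasible set, as the column constraints make
-- Σ_ij x_j (π_ij − φ_ji) vanish; for the shifted costs the 0/1 point of (a, b) wins row by row.
module Submission where

open import Defs
open import Level using (Level; _⊔_)
open import Algebra.Bundles using (CommutativeMonoid; CommutativeRing)
open import Relation.Binary.Bundles using (TotalOrder)
import Relation.Binary.Reasoning.Setoid
import Relation.Binary.Reasoning.PartialOrder
open import Relation.Binary.Core using (Rel)
open import Relation.Binary.Construct.Closure.ReflexiveTransitive using (Star; ε; _◅_; _◅◅_)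
open import Data.Nat as ℕ using (ℕ; zero; suc; s≤s; z≤n)
import Data.Nat.Properties as ℕₚ
open import Data.Nat.Tactic.RingSolver using (solve-∀)
import Algebra.Properties.CommutativeMonoid.Sum
import Algebra.Properties.Semiring.Sum
import Algebra.Properties.Monoid.Mult
import Algebra.Properties.CommutativeSemigroup
open import Data.Fin using (Fin; zero; suc; _≟_)
open import Data.Fin.Properties using (punchInᵢ≢i; all?)
open import Data.Vec.Functional as Vector using (Vector; updateAt; removeAt)
open import Data.Vec.Functional.Properties using (updateAt-updates; updateAt-minimal)
open import Data.List
  using (List; [_]; _++_; map; filter; allFin; concatMap; cartesianProductWith; cartesianProduct)
open import Data.List.Membership.Propositional using (_∈_; lose; find)
open import Data.List.Membership.Propositional.Properties
open import Data.List.Relation.Unary.Any using (here)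
import Data.List.Relation.Unary.All as All
import Data.List.Extrema
open import Data.Product using (∃; ∃₂; _×_; _,_; proj₁; proj₂)
open import Data.Sum using (_⊎_; inj₁; inj₂)
open import Relation.Nullary using (Dec; yes; no)
open import Relation.Nullary.Decidable using (_⊎-dec_)
open import Induction.WellFounded using (Acc; acc)
open import Data.Nat.Induction using (<-wellFounded)
open import Data.Unit using (⊤; tt)
open import Function using (_∘_; const)
open import Relation.Binary.PropositionalEquality as ≡ using (_≡_; _≢_; refl; _≗_)

private
  variable
    ℓ : Level
    A B : Set ℓ

module _ {c ℓ} (M : CommutativeMonoid c ℓ) where
  open CommutativeMonoid M using (Carrier; _≈_; _∙_; ∙-congˡ; ∙-congʳ; sym; setoid)
  open import Algebra.Properties.CommutativeMonoid.Sum M using (sum; sum-remove; sum-cong-≋)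
  open import Algebra.Properties.CommutativeSemigroup (CommutativeMonoid.commutativeSemigroup M) using (xy∙z≈zy∙x)
  open import Relation.Binary.Reasoning.Setoid setoid

  sum-agreeing-off : ∀ {n} (f g : Vector Carrier n) i → (∀ j → j ≢ i → f j ≈ g j) →
                     sum f ∙ g i ≈ sum g ∙ f i
  sum-agreeing-off {suc n} f g i f≈g = begin
    sum f ∙ g i                          ≈⟨ ∙-congʳ (sum-remove f) ⟩
    (f i ∙ sum (removeAt f i)) ∙ g i     ≈⟨ ∙-congʳ (∙-congˡ (sum-cong-≋ (λ j → f≈g _ (punchInᵢ≢i i j)))) ⟩
    (f i ∙ sum (removeAt g i)) ∙ g i     ≈⟨ xy∙z≈zy∙x (f i) _ (g i) ⟩
    (g i ∙ sum (removeAt g i)) ∙ f i     ≈⟨ ∙-congʳ (sym (sum-remove g)) ⟩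
    sum g ∙ f i                          ∎

module ℕ-Sum = Algebra.Properties.CommutativeMonoid.Sum ℕₚ.+-0-commutativeMonoid
module ℕ-+ = Algebra.Properties.CommutativeSemigroup ℕₚ.+-commutativeSemigroup

module _ {i t} {I : Set i} {T : Rel I t} where

  length : ∀ {m l} → Star T m l → ℕ
  length ε       = 0
  length (_ ◅ W) = suc (length W)

  length-◅◅ : ∀ {m k l} (W₁ : Star T m k) (W₂ : Star T k l) → length (W₁ ◅◅ W₂) ≡ length W₁ ℕ.+ length W₂
  length-◅◅ ε        W₂ = refl
  length-◅◅ (_ ◅ W₁) W₂ = ≡.cong suc (length-◅◅ W₁ W₂)

  detour-shorter : ∀ {m u l} (W₁ : Star T m u) (L : Star T u u) (W₃ : Star T u l) →
                   0 ℕ.< length L → 0 ℕ.< length W₁ ℕ.+ length W₃ →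
                   length L ℕ.< length (W₁ ◅◅ L ◅◅ W₃) × length (W₁ ◅◅ W₃) ℕ.< length (W₁ ◅◅ L ◅◅ W₃)
  detour-shorter W₁ L W₃ 0<L 0<W₁W₃ rewrite length-◅◅ W₁ (L ◅◅ W₃) | length-◅◅ L W₃ | length-◅◅ W₁ W₃ =
    ≡.subst (length L ℕ.<_) (ℕ-+.x∙yz≈y∙xz (length L) (length W₁) (length W₃)) (ℕₚ.m<m+n (length L) 0<W₁W₃) ,
    ℕₚ.+-monoʳ-< (length W₁) (ℕₚ.m<n+m (length W₃) 0<L)

allFunctions : ∀ n d → List (Fin n → Fin d)
allFunctions zero    d = [ Vector.[] ]
allFunctions (suc n) d = cartesianProductWith Vector._∷_ (allFin d) (allFunctions n d)

∈-allFunctions : ∀ {n d} (f : Fin n → Fin d) → ∃ λ g → g ∈ allFunctions n d × g ≗ f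
∈-allFunctions {zero}  f = Vector.[] , here refl , λ ()
∈-allFunctions {suc n} f with g , g∈ , g≗ ← ∈-allFunctions (f ∘ suc) =
  f zero Vector.∷ g , ∈-cartesianProductWith⁺ Vector._∷_ (∈-allFin (f zero)) g∈ , λ where
    zero    → refl
    (suc i) → g≗ i

gather : ∀ {N} → (Fin N → A → B) → (Fin N → List A) → List B
gather f xs = concatMap (λ m → map (f m) (xs m)) (allFin _)

∈-gather⁺ : ∀ {N} (f : Fin N → A → B) xs {m w} → w ∈ xs m → f m w ∈ gather f xs
∈-gather⁺ f xs {m} w∈xs = ∈-concatMap⁺ _ (lose (∈-allFin m) (∈-map⁺ (f m) w∈xs))

∈-gather⁻ : ∀ {N} (f : Fin N → A → B) xs {y} → y ∈ gather f xs → ∃₂ λ m w → w ∈ xs m × y ≡ f m w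
∈-gather⁻ f xs y∈ with m , _ , y∈m ← find (∈-concatMap⁻ _ {xs = allFin _} y∈)
                   with w , w∈ , refl ← ∈-map⁻ (f m) y∈m =
  m , w , w∈ , refl

AssignmentPair : ℕ → ℕ → Set
AssignmentPair n d = (Fin n → Fin d) × (Fin n → Fin d)

δ : ∀ {d} → Fin d → Fin d → ℕ
δ zero    zero    = 1
δ zero    (suc _) = 0
δ (suc _) zero    = 0
δ (suc p) (suc q) = δ p q

δ≡0⊎δ≡1 : ∀ {d} (p q : Fin d) → δ p q ≡ 0 ⊎ δ p q ≡ 1
δ≡0⊎δ≡1 zero    zero    = inj₂ refl
δ≡0⊎δ≡1 zero    (suc _) = inj₁ refl
δ≡0⊎δ≡1 (suc _) zero    = inj₁ refl
δ≡0⊎δ≡1 (suc p) (suc q) = δ≡0⊎δ≡1 p q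

count : ∀ {n d} → (Fin n → Fin d) → Fin d → ℕ
count f j = ℕ-Sum.sum (λ i → δ (f i) j)

count-cong : ∀ {n d} {f g : Fin n → Fin d} → f ≗ g → count f ≗ count g
count-cong f≗g j = ℕ-Sum.sum-cong-≗ (λ i → ≡.cong (λ p → δ p j) (f≗g i))

Balanced : ∀ {n d} → (Fin n → Fin d) → (Fin n → Fin d) → Set
Balanced a b = ∀ j → count a j ≡ count b j

balanced? : ∀ {n d} (s : AssignmentPair n d) → Dec (Balanced (proj₁ s) (proj₂ s))
balanced? (a , b) = all? (λ j → count a j ℕ.≟ count b j)

count-updateAt : ∀ {n d} (f : Fin n → Fin d) i k j →
                 count (updateAt f i (const k)) j ℕ.+ δ (f i) j ≡ count f j ℕ.+ δ k j
count-updateAt f i k j =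
  ≡.subst (λ p → count (updateAt f i (const k)) j ℕ.+ δ (f i) j ≡ count f j ℕ.+ δ p j)
          (updateAt-updates i f)
          (sum-agreeing-off ℕₚ.+-0-commutativeMonoid _ _ i
            (λ i′ i′≢i → ≡.cong (λ p → δ p j) (updateAt-minimal i′ i f i′≢i)))

-- Going from s₀ to s₁ moves the imbalance count a − count b by one unit from m to l; both sides
-- are moved so that no subtraction occurs.
record Shifted {n d} (s₀ s₁ : AssignmentPair n d) (m l : Fin d) : Set where
  constructor shifted
  field
    counts : ∀ j → count (proj₁ s₁) j ℕ.+ count (proj₂ s₀) j ℕ.+ δ m j ≡
                   count (proj₁ s₀) j ℕ.+ count (proj₂ s₁) j ℕ.+ δ l j

Shifted-refl : ∀ {n d} {s : AssignmentPair n d} {m} → Shifted s s m m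
Shifted-refl = shifted λ _ → refl

Shifted-trans : ∀ {n d} {s₀ s₁ s₂ : AssignmentPair n d} {m k l} →
                Shifted s₀ s₁ m k → Shifted s₁ s₂ k l → Shifted s₀ s₂ m l
Shifted-trans {s₀ = a₀ , b₀} {a₁ , b₁} {a₂ , b₂} {m} {k} {l} (shifted s₀⇝s₁) (shifted s₁⇝s₂) = shifted counts
  where
  open import Data.Nat using (_+_)
  exchange₁ : ∀ x y z u v w → (x + y + z) + (u + v + w) ≡ (x + v + w) + (u + y + z)
  exchange₁ = solve-∀
  exchange₂ : ∀ x y z u v w → (x + y + z) + (u + v + w) ≡ (u + y + z) + (x + v + w)
  exchange₂ = solve-∀

  counts : ∀ j → count a₂ j + count b₀ j + δ m j ≡ count a₀ j + count b₂ j + δ l j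
  counts j = ℕₚ.+-cancelʳ-≡ _ _ _ (begin
    (A₂ + B₀ + δ m j) + (A₁ + B₁ + δ k j)  ≡⟨ exchange₁ A₂ B₀ (δ m j) A₁ B₁ (δ k j) ⟩
    (A₂ + B₁ + δ k j) + (A₁ + B₀ + δ m j)  ≡⟨ ≡.cong₂ _+_ (s₁⇝s₂ j) (s₀⇝s₁ j) ⟩
    (A₁ + B₂ + δ l j) + (A₀ + B₁ + δ k j)  ≡⟨ exchange₂ A₁ B₂ (δ l j) A₀ B₁ (δ k j) ⟩
    (A₀ + B₂ + δ l j) + (A₁ + B₁ + δ k j)  ∎)
    where
    open ≡.≡-Reasoning
    A₀ = count a₀ j; A₁ = count a₁ j; A₂ = count a₂ j
    B₀ = count b₀ j; B₁ = count b₁ j; B₂ = count b₂ j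

Shifted-balanced : ∀ {n d} {a b a′ b′ : Fin n → Fin d} {m} →
                   Shifted (a , b) (a′ , b′) m m → Balanced a b → Balanced a′ b′
Shifted-balanced {a = a} {b} {a′} {b′} (shifted counts) balanced j = ℕₚ.+-cancelʳ-≡ _ _ _ (begin
  count a′ j ℕ.+ count b j    ≡⟨ ℕₚ.+-cancelʳ-≡ _ _ _ (counts j) ⟩
  count a j ℕ.+ count b′ j    ≡⟨ ≡.cong (ℕ._+ count b′ j) (balanced j) ⟩
  count b j ℕ.+ count b′ j    ≡⟨ ℕₚ.+-comm (count b j) (count b′ j) ⟩
  count b′ j ℕ.+ count b j    ∎)
  where open ≡.≡-Reasoning

updateAt-shiftsˡ : ∀ {n d} (a₀ b₀ : Fin n → Fin d) i {m} k → a₀ i ≡ m →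
                   Shifted (a₀ , b₀) (updateAt a₀ i (const k) , b₀) m k
updateAt-shiftsˡ a₀ b₀ i k refl = shifted λ j → let open ≡.≡-Reasoning; a₁ = updateAt a₀ i (const k) in begin
  count a₁ j ℕ.+ count b₀ j ℕ.+ δ (a₀ i) j    ≡⟨ ℕ-+.xy∙z≈xz∙y (count a₁ j) _ _ ⟩
  count a₁ j ℕ.+ δ (a₀ i) j ℕ.+ count b₀ j    ≡⟨ ≡.cong (ℕ._+ count b₀ j) (count-updateAt a₀ i k j) ⟩
  count a₀ j ℕ.+ δ k j ℕ.+ count b₀ j         ≡⟨ ℕ-+.xy∙z≈xz∙y (count a₀ j) _ _ ⟩
  count a₀ j ℕ.+ count b₀ j ℕ.+ δ k j         ∎

updateAt-shiftsʳ : ∀ {n d} (a₀ b₀ : Fin n → Fin d) i m {k} → b₀ i ≡ k →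
                   Shifted (a₀ , b₀) (a₀ , updateAt b₀ i (const m)) m k
updateAt-shiftsʳ a₀ b₀ i m refl = shifted λ j → let open ≡.≡-Reasoning; b₁ = updateAt b₀ i (const m) in begin
  count a₀ j ℕ.+ count b₀ j ℕ.+ δ m j         ≡⟨ ℕₚ.+-assoc (count a₀ j) _ _ ⟩
  count a₀ j ℕ.+ (count b₀ j ℕ.+ δ m j)       ≡⟨ ≡.cong (count a₀ j ℕ.+_) (count-updateAt b₀ i m j) ⟨
  count a₀ j ℕ.+ (count b₁ j ℕ.+ δ (b₀ i) j)  ≡⟨ ℕₚ.+-assoc (count a₀ j) _ _ ⟨
  count a₀ j ℕ.+ count b₁ j ℕ.+ δ (b₀ i) j    ∎

-- Ordered fields

module _ {c ℓ₁ ℓ₂} (F : OrderedField c ℓ₁ ℓ₂) where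
  open OrderedField F

  commutativeRing : CommutativeRing c ℓ₁
  commutativeRing = record { isCommutativeRing = isCommutativeRing }

  totalOrder : TotalOrder c ℓ₁ ℓ₂
  totalOrder = record { isTotalOrder = isTotalOrder }

  open CommutativeRing commutativeRing
    using ( setoid; ring; +-commutativeMonoid; +-abelianGroup; +-cong; +-congˡ; +-congʳ; +-assoc; +-comm
          ; +-identityˡ; +-identityʳ; -‿inverseʳ; -‿cong; *-congˡ; *-congʳ; *-identityˡ; *-identityʳ
          ; zeroʳ; distribʳ )
    renaming (refl to ≈-refl; sym to ≈-sym; trans to ≈-trans; reflexive to ≈-reflexive)
  open TotalOrder totalOrder using (poset)
    renaming (total to ≤-total; refl to ≤-refl; trans to ≤-trans; reflexive to ≤-reflexive)
  open import Algebra.Properties.AbelianGroup +-abelianGroup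
    using ( //-rightDividesˡ; //-rightDividesʳ; \\-leftDividesʳ; ⁻¹-∙-comm; ⁻¹-anti-homo‿-; ⁻¹-involutive
          ; xyx⁻¹≈y; x∙y⁻¹≈ε⇒x≈y )
  open import Algebra.Properties.Ring ring using ([y-z]x≈yx-zx; -1*x≈-x)
  open import Algebra.Properties.CommutativeSemigroup (CommutativeRing.+-commutativeSemigroup commutativeRing)
    using (interchange; xy∙z≈xz∙y; x∙yz≈y∙xz)
  module ≈-Reasoning = Relation.Binary.Reasoning.Setoid setoid
  module Extrema = Data.List.Extrema totalOrder
  module ≤-Reasoning = Relation.Binary.Reasoning.PartialOrder poset

  +-monoʳ-≤ : ∀ z {x y} → x ≤ y → z + x ≤ z + y
  +-monoʳ-≤ z {x} {y} x≤y = begin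
    z + x  ≈⟨ +-comm z x ⟩
    x + z  ≤⟨ +-monoˡ-≤ z x≤y ⟩
    y + z  ≈⟨ +-comm y z ⟩
    z + y  ∎
    where open ≤-Reasoning

  +-mono-≤ : ∀ {x y u w} → x ≤ y → u ≤ w → x + u ≤ y + w
  +-mono-≤ {y = y} {u} x≤y u≤w = ≤-trans (+-monoˡ-≤ u x≤y) (+-monoʳ-≤ y u≤w)

  x≤y+z⇒x-z≤y : ∀ {x y z} → x ≤ y + z → x - z ≤ y
  x≤y+z⇒x-z≤y {x} {y} {z} x≤y+z = begin
    x - z        ≤⟨ +-monoˡ-≤ (- z) x≤y+z ⟩
    y + z - z    ≈⟨ //-rightDividesʳ z y ⟩
    y            ∎
    where open ≤-Reasoning

  x-z≤y⇒x≤y+z : ∀ {x y z} → x - z ≤ y → x ≤ y + z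
  x-z≤y⇒x≤y+z {x} {y} {z} x-z≤y = begin
    x            ≈⟨ //-rightDividesˡ z x ⟨
    x - z + z    ≤⟨ +-monoˡ-≤ z x-z≤y ⟩
    y + z        ∎
    where open ≤-Reasoning

  x≤y⇒0≤y-x : ∀ {x y} → x ≤ y → 0# ≤ y - x
  x≤y⇒0≤y-x {x} {y} x≤y = begin
    0#      ≈⟨ -‿inverseʳ x ⟨
    x - x   ≤⟨ +-monoˡ-≤ (- x) x≤y ⟩
    y - x   ∎
    where open ≤-Reasoning

  0≤y-x⇒x≤y : ∀ {x y} → 0# ≤ y - x → x ≤ y
  0≤y-x⇒x≤y {x} {y} 0≤y-x = begin
    x           ≈⟨ +-identityˡ x ⟨
    0# + x      ≤⟨ +-monoˡ-≤ x 0≤y-x ⟩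
    y - x + x   ≈⟨ //-rightDividesˡ x y ⟩
    y           ∎
    where open ≤-Reasoning

  x≤x+y⇒0≤y : ∀ {x y} → x ≤ x + y → 0# ≤ y
  x≤x+y⇒0≤y {x} {y} x≤x+y = begin
    0#      ≈⟨ -‿inverseʳ x ⟨
    x - x   ≤⟨ x≤y+z⇒x-z≤y (≤-trans x≤x+y (≤-reflexive (+-comm x y))) ⟩
    y       ∎
    where open ≤-Reasoning

  neg-mono-≤ : ∀ {x y} → x ≤ y → - y ≤ - x
  neg-mono-≤ {x} {y} x≤y = begin
    - y          ≈⟨ xyx⁻¹≈y x (- y) ⟨
    x - y - x    ≤⟨ +-monoˡ-≤ (- x) (+-monoˡ-≤ (- y) x≤y) ⟩
    y - y - x    ≈⟨ +-congʳ (-‿inverseʳ y) ⟩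
    0# - x       ≈⟨ +-identityˡ (- x) ⟩
    - x          ∎
    where open ≤-Reasoning

  -‿mono-≤ : ∀ {x y u w} → x ≤ y → u ≤ w → x - w ≤ y - u
  -‿mono-≤ x≤y u≤w = +-mono-≤ x≤y (neg-mono-≤ u≤w)

  *-monoˡ-≤-nonNeg : ∀ {x y z} → 0# ≤ z → x ≤ y → x * z ≤ y * z
  *-monoˡ-≤-nonNeg {x} {y} {z} 0≤z x≤y = 0≤y-x⇒x≤y (begin
    0#                ≤⟨ *-nonneg (x≤y⇒0≤y-x x≤y) 0≤z ⟩
    (y - x) * z       ≈⟨ [y-z]x≈yx-zx z y x ⟩
    y * z - x * z     ∎)
    where open ≤-Reasoning

  0≤1 : 0# ≤ 1#
  0≤1 with ≤-total 0# 1#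
  ... | inj₁ 0≤1 = 0≤1
  ... | inj₂ 1≤0 = begin
    0#            ≤⟨ *-nonneg 0≤-1 0≤-1 ⟩
    - 1# * - 1#   ≈⟨ -1*x≈-x (- 1#) ⟩
    - (- 1#)      ≈⟨ ⁻¹-involutive 1# ⟩
    1#            ∎
    where
    open ≤-Reasoning
    0≤-1 : 0# ≤ - 1#
    0≤-1 = ≤-trans (x≤y⇒0≤y-x 1≤0) (≤-reflexive (+-identityˡ (- 1#)))

  module Sum = Algebra.Properties.Semiring.Sum (CommutativeRing.semiring commutativeRing)

  Σ≡sum : ∀ m (f : Fin m → Carrier) → Σ m f ≡ Sum.sum f
  Σ≡sum zero    f = refl
  Σ≡sum (suc m) f = ≡.cong (f zero +_) (Σ≡sum m (f ∘ suc))

  Σ-cong : ∀ m {f g : Fin m → Carrier} → (∀ i → f i ≈ g i) → Σ m f ≈ Σ m g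
  Σ-cong zero    f≈g = ≈-refl
  Σ-cong (suc m) f≈g = +-cong (f≈g zero) (Σ-cong m (f≈g ∘ suc))

  Σ-mono-≤ : ∀ m {f g : Fin m → Carrier} → (∀ i → f i ≤ g i) → Σ m f ≤ Σ m g
  Σ-mono-≤ zero    f≤g = ≤-refl
  Σ-mono-≤ (suc m) f≤g = +-mono-≤ (f≤g zero) (Σ-mono-≤ m (f≤g ∘ suc))

  Σ-zero : ∀ m → Σ m (λ _ → 0#) ≈ 0#
  Σ-zero m rewrite Σ≡sum m (λ _ → 0#) = Sum.sum-replicate-zero m

  Σ-distrib-+ : ∀ m (f g : Fin m → Carrier) → Σ m (λ i → f i + g i) ≈ Σ m f + Σ m g
  Σ-distrib-+ m f g rewrite Σ≡sum m (λ i → f i + g i) | Σ≡sum m f | Σ≡sum m g = Sum.∑-distrib-+ f g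

  *-distribˡ-Σ : ∀ m x (f : Fin m → Carrier) → x * Σ m f ≈ Σ m (λ i → x * f i)
  *-distribˡ-Σ m x f rewrite Σ≡sum m f | Σ≡sum m (λ i → x * f i) = Sum.*-distribˡ-sum x f

  Σ-agreeing-off : ∀ m (f g : Fin m → Carrier) i → (∀ j → j ≢ i → f j ≈ g j) →
                   Σ m f + g i ≈ Σ m g + f i
  Σ-agreeing-off m f g i rewrite Σ≡sum m f | Σ≡sum m g = sum-agreeing-off +-commutativeMonoid f g i

  Σ-comm : ∀ m k (f : Fin m → Fin k → Carrier) →
           Σ m (λ i → Σ k (f i)) ≈ Σ k (λ j → Σ m (λ i → f i j))
  Σ-comm zero    k f = ≈-sym (Σ-zero k)
  Σ-comm (suc m) k f = begin
    Σ k (f zero) + Σ m (λ i → Σ k (f (suc i)))         ≈⟨ +-congˡ (Σ-comm m k (f ∘ suc)) ⟩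
    Σ k (f zero) + Σ k (λ j → Σ m (λ i → f (suc i) j)) ≈⟨ Σ-distrib-+ k (f zero) _ ⟨
    Σ k (λ j → Σ (suc m) (λ i → f i j))                ∎
    where open ≈-Reasoning

  [x+y]-[z+w]≈[x-z]+[y-w] : ∀ x y z w → (x + y) - (z + w) ≈ (x - z) + (y - w)
  [x+y]-[z+w]≈[x-z]+[y-w] x y z w = begin
    (x + y) + - (z + w)        ≈⟨ +-congˡ (⁻¹-∙-comm z w) ⟨
    (x + y) + (- z + - w)      ≈⟨ interchange x y (- z) (- w) ⟩
    (x + - z) + (y + - w)      ∎
    where open ≈-Reasoning

  Σ-distrib-- : ∀ m (f g : Fin m → Carrier) → Σ m (λ i → f i - g i) ≈ Σ m f - Σ m g
  Σ-distrib-- zero    f g = ≈-sym (-‿inverseʳ 0#)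
  Σ-distrib-- (suc m) f g = ≈-trans (+-congˡ (Σ-distrib-- m (f ∘ suc) (g ∘ suc)))
                                    (≈-sym ([x+y]-[z+w]≈[x-z]+[y-w] _ _ _ _))

  x+y≈z+w⇒x≈z+[w-y] : ∀ {x y z w} → x + y ≈ z + w → x ≈ z + (w - y)
  x+y≈z+w⇒x≈z+[w-y] {x} {y} {z} {w} x+y≈z+w = begin
    x              ≈⟨ //-rightDividesʳ y x ⟨
    x + y - y      ≈⟨ +-congʳ x+y≈z+w ⟩
    z + w - y      ≈⟨ +-assoc z w (- y) ⟩
    z + (w - y)    ∎
    where open ≈-Reasoning

  x+y≈z+w⇒x-u≈[z-u]+[w-y] : ∀ {x y z w} u → x + y ≈ z + w → x - u ≈ (z - u) + (w - y)
  x+y≈z+w⇒x-u≈[z-u]+[w-y] {y = y} {z} {w} u x+y≈z+w =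
    ≈-trans (+-congʳ (x+y≈z+w⇒x≈z+[w-y] x+y≈z+w)) (xy∙z≈xz∙y z (w - y) (- u))

  x+y≈z+w⇒u-x≈[u-z]+[y-w] : ∀ {x y z w} u → x + y ≈ z + w → u - x ≈ (u - z) + (y - w)
  x+y≈z+w⇒u-x≈[u-z]+[y-w] {x} {y} {z} {w} u x+y≈z+w = begin
    u - x                    ≈⟨ +-congˡ (-‿cong (x+y≈z+w⇒x≈z+[w-y] x+y≈z+w)) ⟩
    u - (z + (w - y))        ≈⟨ +-congˡ (⁻¹-∙-comm z (w - y)) ⟨
    u + (- z + - (w - y))    ≈⟨ +-congˡ (+-congˡ (⁻¹-anti-homo‿- w y)) ⟩
    u + (- z + (y - w))      ≈⟨ +-assoc u (- z) (y - w) ⟨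
    (u - z) + (y - w)        ∎
    where open ≈-Reasoning

  y≤x+[p-q]⇒q-x≤p-y : ∀ {x y p q} → y ≤ x + (p - q) → q - x ≤ p - y
  y≤x+[p-q]⇒q-x≤p-y {x} {y} {p} {q} y≤x+[p-q] = begin
    q - x                   ≈⟨ //-rightDividesʳ y (q - x) ⟨
    q - x + y - y           ≤⟨ +-monoˡ-≤ (- y) q-x+y≤p ⟩
    p - y                   ∎
    where
    open ≤-Reasoning
    q-x+y≤p : q - x + y ≤ p
    q-x+y≤p = begin
      q - x + y                    ≤⟨ +-monoʳ-≤ (q - x) y≤x+[p-q] ⟩
      q - x + (x + (p - q))        ≈⟨ +-assoc q (- x) _ ⟩
      q + (- x + (x + (p - q)))    ≈⟨ +-congˡ (\\-leftDividesʳ x (p - q)) ⟩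
      q + (p - q)                  ≈⟨ +-comm q (p - q) ⟩
      p - q + q                    ≈⟨ //-rightDividesˡ q p ⟩
      p                            ∎

  -- The linear program and its 0/1 points

  module Mult = Algebra.Properties.Monoid.Mult (CommutativeRing.+-monoid commutativeRing)

  𝟙 : ∀ {d} → Fin d → Fin d → Carrier
  𝟙 p q = δ p q Mult.× 1#

  𝟙≈0⊎𝟙≈1 : ∀ {d} (p q : Fin d) → 𝟙 p q ≈ 0# ⊎ 𝟙 p q ≈ 1#
  𝟙≈0⊎𝟙≈1 p q with δ p q | δ≡0⊎δ≡1 p q
  ... | _ | inj₁ refl = inj₁ ≈-refl
  ... | _ | inj₂ refl = inj₂ (+-identityʳ 1#)

  0≤𝟙 : ∀ {d} (p q : Fin d) → 0# ≤ 𝟙 p q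
  0≤𝟙 p q with 𝟙≈0⊎𝟙≈1 p q
  ... | inj₁ 𝟙≈0 = ≤-reflexive (≈-sym 𝟙≈0)
  ... | inj₂ 𝟙≈1 = ≤-trans 0≤1 (≤-reflexive (≈-sym 𝟙≈1))

  Σ-*𝟙 : ∀ d (u : Fin d → Carrier) p → Σ d (λ j → u j * 𝟙 p j) ≈ u p
  Σ-*𝟙 (suc d) u zero = begin
    u zero * (1# + 0#) + Σ d (λ j → u (suc j) * 0#)
      ≈⟨ +-cong (*-congˡ (+-identityʳ 1#)) (Σ-cong d (λ j → zeroʳ (u (suc j)))) ⟩
    u zero * 1# + Σ d (λ _ → 0#)                      ≈⟨ +-cong (*-identityʳ (u zero)) (Σ-zero d) ⟩
    u zero + 0#                                       ≈⟨ +-identityʳ (u zero) ⟩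
    u zero                                            ∎
    where open ≈-Reasoning
  Σ-*𝟙 (suc d) u (suc p) = begin
    u zero * 0# + Σ d (λ j → u (suc j) * 𝟙 p j)   ≈⟨ +-congʳ (zeroʳ (u zero)) ⟩
    0# + Σ d (λ j → u (suc j) * 𝟙 p j)            ≈⟨ +-identityˡ _ ⟩
    Σ d (λ j → u (suc j) * 𝟙 p j)                 ≈⟨ Σ-*𝟙 d (u ∘ suc) p ⟩
    u (suc p)                                     ∎
    where open ≈-Reasoning

  Σ-𝟙 : ∀ d (p : Fin d) → Σ d (𝟙 p) ≈ 1#
  Σ-𝟙 d p = ≈-trans (Σ-cong d (λ j → ≈-sym (*-identityˡ (𝟙 p j)))) (Σ-*𝟙 d (λ _ → 1#) p)

  Σ-𝟙-count : ∀ n {d} (f : Fin n → Fin d) j → Σ n (λ i → 𝟙 (f i) j) ≈ count f j Mult.× 1#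
  Σ-𝟙-count zero    f j = ≈-refl
  Σ-𝟙-count (suc n) f j = ≈-trans (+-congˡ (Σ-𝟙-count n (f ∘ suc) j))
                                  (≈-sym (Mult.×-homo-+ 1# (δ (f zero) j) (count (f ∘ suc) j)))

  weighted-average-≥ : ∀ d (w p : Fin d → Carrier) {m} → (∀ j → 0# ≤ p j) → Σ d p ≈ 1# →
                       (∀ j → m ≤ w j) → m ≤ Σ d (λ j → w j * p j)
  weighted-average-≥ d w p {m} 0≤p Σp≈1 m≤w = begin
    m                       ≈⟨ *-identityʳ m ⟨
    m * 1#                  ≈⟨ *-congˡ Σp≈1 ⟨
    m * Σ d p               ≈⟨ *-distribˡ-Σ d m p ⟩
    Σ d (λ j → m * p j)     ≤⟨ Σ-mono-≤ d (λ j → *-monoˡ-≤-nonNeg (0≤p j) (m≤w j)) ⟩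
    Σ d (λ j → w j * p j)   ∎
    where open ≤-Reasoning

  weighted-average-≤ : ∀ d (w p : Fin d → Carrier) {M} → (∀ j → 0# ≤ p j) → Σ d p ≈ 1# →
                       (∀ j → w j ≤ M) → Σ d (λ j → w j * p j) ≤ M
  weighted-average-≤ d w p {M} 0≤p Σp≈1 w≤M = begin
    Σ d (λ j → w j * p j)   ≤⟨ Σ-mono-≤ d (λ j → *-monoˡ-≤-nonNeg (0≤p j) (w≤M j)) ⟩
    Σ d (λ j → M * p j)     ≈⟨ *-distribˡ-Σ d M p ⟨
    M * Σ d p               ≈⟨ *-congˡ Σp≈1 ⟩
    M * 1#                  ≈⟨ *-identityʳ M ⟩
    M                       ∎
    where open ≤-Reasoning

  module _ {n d : ℕ} where
    private module LP = DualLP F n d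

    π⟨_⟩ : (Fin n → Fin d) → Fin n → Fin d → Carrier
    π⟨ a ⟩ i j = 𝟙 (a i) j

    φ⟨_⟩ : (Fin n → Fin d) → Fin d → Fin n → Carrier
    φ⟨ b ⟩ j i = 𝟙 (b i) j

    ⟨⟩-feasible : ∀ {v} a b → Balanced a b → LP.Feasible v π⟨ a ⟩ φ⟨ b ⟩
    ⟨⟩-feasible a b balanced =
      (λ i j → 0≤𝟙 (a i) j) , (λ j i → 0≤𝟙 (b i) j) , columns , (λ i → Σ-𝟙 d (a i)) , (λ i → Σ-𝟙 d (b i))
      where
      columns : ∀ j → Σ n (λ i → 𝟙 (a i) j - 𝟙 (b i) j) ≈ 0#
      columns j = begin
        Σ n (λ i → 𝟙 (a i) j - 𝟙 (b i) j)              ≈⟨ Σ-distrib-- n _ _ ⟩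
        Σ n (λ i → 𝟙 (a i) j) - Σ n (λ i → 𝟙 (b i) j)  ≈⟨ +-cong (Σ-𝟙-count n a j) (-‿cong (Σ-𝟙-count n b j)) ⟩
        count a j Mult.× 1# - count b j Mult.× 1#
          ≡⟨ ≡.cong (λ k → k Mult.× 1# - count b j Mult.× 1#) (balanced j) ⟩
        count b j Mult.× 1# - count b j Mult.× 1#      ≈⟨ -‿inverseʳ _ ⟩
        0#                                             ∎
        where open ≈-Reasoning

    objective-⟨⟩ : ∀ v a b → LP.objective v π⟨ a ⟩ φ⟨ b ⟩ ≈ Σ n (λ i → v i (a i)) - Σ n (λ i → v i (b i))
    objective-⟨⟩ v a b = +-cong (Σ-cong n (λ i → Σ-*𝟙 d (v i) (a i)))
                                (-‿cong (Σ-cong n (λ i → Σ-*𝟙 d (v i) (b i))))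

    objective-shift : ∀ v (x : Fin d → Carrier) {π φ} → LP.Feasible v π φ →
                      LP.objective v π φ ≈ LP.objective (λ i j → v i j - x j) π φ
    objective-shift v x {π} {φ} (_ , _ , columns , _ , _) = begin
      V π - V φᵀ                                ≈⟨ +-cong (split π) (-‿cong (split φᵀ)) ⟩
      (U π + X π) - (U φᵀ + X φᵀ)               ≈⟨ +-congˡ (-‿cong (+-congˡ X-equal)) ⟩
      (U π + X π) - (U φᵀ + X π)                ≈⟨ [x+y]-[z+w]≈[x-z]+[y-w] _ _ _ _ ⟩
      (U π - U φᵀ) + (X π - X π)                ≈⟨ +-congˡ (-‿inverseʳ (X π)) ⟩
      (U π - U φᵀ) + 0#                         ≈⟨ +-identityʳ _ ⟩
      U π - U φᵀ                                ∎
      where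
      open ≈-Reasoning
      φᵀ : Fin n → Fin d → Carrier
      φᵀ i j = φ j i
      V U X : (Fin n → Fin d → Carrier) → Carrier
      V ψ = Σ n (λ i → Σ d (λ j → v i j * ψ i j))
      U ψ = Σ n (λ i → Σ d (λ j → (v i j - x j) * ψ i j))
      X ψ = Σ n (λ i → Σ d (λ j → x j * ψ i j))

      split : ∀ ψ → V ψ ≈ U ψ + X ψ
      split ψ = ≈-trans (Σ-cong n (λ i → ≈-trans (Σ-cong d (λ j → v*ψ≈u*ψ+x*ψ i j)) (Σ-distrib-+ d _ _)))
                        (Σ-distrib-+ n _ _)
        where
        v*ψ≈u*ψ+x*ψ : ∀ i j → v i j * ψ i j ≈ (v i j - x j) * ψ i j + x j * ψ i j
        v*ψ≈u*ψ+x*ψ i j = ≈-trans (*-congʳ (≈-sym (//-rightDividesˡ (x j) (v i j)))) (distribʳ (ψ i j) _ (x j))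

      X-by-columns : ∀ ψ → X ψ ≈ Σ d (λ j → x j * Σ n (λ i → ψ i j))
      X-by-columns ψ = ≈-trans (Σ-comm n d _) (Σ-cong d (λ j → ≈-sym (*-distribˡ-Σ n (x j) _)))

      X-equal : X φᵀ ≈ X π
      X-equal = begin
        X φᵀ                                      ≈⟨ X-by-columns φᵀ ⟩
        Σ d (λ j → x j * Σ n (λ i → φ j i))       ≈⟨ Σ-cong d (λ j → *-congˡ (column-sums j)) ⟨
        Σ d (λ j → x j * Σ n (λ i → π i j))       ≈⟨ X-by-columns π ⟨
        X π                                       ∎
        where
        column-sums : ∀ j → Σ n (λ i → π i j) ≈ Σ n (λ i → φ j i)
        column-sums j = x∙y⁻¹≈ε⇒x≈y _ _ (≈-trans (≈-sym (Σ-distrib-- n _ _)) (columns j))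

    ⟨⟩-optimal : ∀ v (x : Fin d → Carrier) {a b} → Balanced a b →
                 (∀ i k → v i (a i) - x (a i) ≤ v i k - x k) →
                 (∀ i k → v i k - x k ≤ v i (b i) - x (b i)) →
                 LP.Optimal v π⟨ a ⟩ φ⟨ b ⟩
    ⟨⟩-optimal v x {a} {b} balanced a-minimises b-maximises = ⟨⟩-feasible {v} a b balanced , optimal
      where
      u : Fin n → Fin d → Carrier
      u i j = v i j - x j

      optimal : ∀ π φ → LP.Feasible v π φ → LP.objective v π⟨ a ⟩ φ⟨ b ⟩ ≤ LP.objective v π φ
      optimal π φ feasible@(0≤π , 0≤φ , _ , rows-π , rows-φ) = begin
        LP.objective v π⟨ a ⟩ φ⟨ b ⟩                      ≈⟨ objective-shift v x (⟨⟩-feasible {v} a b balanced) ⟩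
        LP.objective u π⟨ a ⟩ φ⟨ b ⟩                      ≈⟨ objective-⟨⟩ u a b ⟩
        Σ n (λ i → u i (a i)) - Σ n (λ i → u i (b i))   ≤⟨ -‿mono-≤ (Σ-mono-≤ n π-bound) (Σ-mono-≤ n φ-bound) ⟩
        LP.objective u π φ                              ≈⟨ objective-shift v x feasible ⟨
        LP.objective v π φ                              ∎
        where
        open ≤-Reasoning
        π-bound : ∀ i → u i (a i) ≤ Σ d (λ j → u i j * π i j)
        π-bound i = weighted-average-≥ d (u i) (π i) (0≤π i) (rows-π i) (a-minimises i)
        φ-bound : ∀ i → Σ d (λ j → u i j * φ j i) ≤ u i (b i)
        φ-bound i = weighted-average-≤ d (u i) (λ j → φ j i) (λ j → 0≤φ j i) (rows-φ i) (b-maximises i)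

  -- Potentials of weighted graphs without negative cycles

  module _ {i t} {I : Set i} {T : Rel I t} (weightOf : ∀ {m k} → T m k → Carrier) where

    weight : ∀ {m l} → Star T m l → Carrier
    weight ε       = 0#
    weight (e ◅ W) = weightOf e + weight W

    weight-◅◅ : ∀ {m k l} (W₁ : Star T m k) (W₂ : Star T k l) → weight (W₁ ◅◅ W₂) ≈ weight W₁ + weight W₂
    weight-◅◅ ε        W₂ = ≈-sym (+-identityˡ (weight W₂))
    weight-◅◅ (e ◅ W₁) W₂ = ≈-trans (+-congˡ (weight-◅◅ W₁ W₂)) (≈-sym (+-assoc _ _ _))

    weight-detour : ∀ {m u l} (W₁ : Star T m u) (L : Star T u u) (W₃ : Star T u l) →
                    weight (W₁ ◅◅ L ◅◅ W₃) ≈ weight L + weight (W₁ ◅◅ W₃)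
    weight-detour W₁ L W₃ = begin
      weight (W₁ ◅◅ L ◅◅ W₃)                ≈⟨ weight-◅◅ W₁ (L ◅◅ W₃) ⟩
      weight W₁ + weight (L ◅◅ W₃)          ≈⟨ +-congˡ (weight-◅◅ L W₃) ⟩
      weight W₁ + (weight L + weight W₃)    ≈⟨ x∙yz≈y∙xz (weight W₁) (weight L) (weight W₃) ⟩
      weight L + (weight W₁ + weight W₃)    ≈⟨ +-congˡ (weight-◅◅ W₁ W₃) ⟨
      weight L + weight (W₁ ◅◅ W₃)          ∎
      where open ≈-Reasoning

  Graph : ℕ → Set c
  Graph N = Fin N → Fin N → List Carrier

  module _ {N} (G : Graph N) where

    Edge : Fin N → Fin N → Set c
    Edge m k = ∃ λ w → w ∈ G m k

    NoNegativeCycle : Set (c ⊔ ℓ₂)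
    NoNegativeCycle = ∀ {m} (C : Star Edge m m) → 0# ≤ weight proj₁ C

    Potential : (Fin N → Carrier) → Set (c ⊔ ℓ₂)
    Potential x = ∀ {m k w} → w ∈ G m k → x k ≤ x m + w

  module _ {N} (G : Graph (suc N)) where

    eliminate : Graph N
    eliminate m k = G (suc m) (suc k) ++ cartesianProductWith _+_ (G (suc m) zero) (G zero (suc k))

    unfold : ∀ {m l} (W : Star (Edge eliminate) m l) →
             ∃ λ (W′ : Star (Edge G) (suc m) (suc l)) → weight proj₁ W′ ≈ weight proj₁ W
    unfold ε = ε , ≈-refl
    unfold (_◅_ {m} {k} (w , w∈) W) with W′ , W′≈W ← unfold W with ∈-++⁻ (G (suc m) (suc k)) w∈
    ... | inj₁ direct = (w , direct) ◅ W′ , +-congˡ W′≈W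
    ... | inj₂ via-zero
      with w₁ , w₂ , w₁∈ , w₂∈ , refl ← ∈-cartesianProductWith⁻ _+_ (G (suc m) zero) (G zero (suc k)) via-zero =
      (w₁ , w₁∈) ◅ (w₂ , w₂∈) ◅ W′ , ≈-trans (≈-sym (+-assoc w₁ w₂ _)) (+-congˡ W′≈W)

    eliminate-noNegativeCycle : NoNegativeCycle G → NoNegativeCycle eliminate
    eliminate-noNegativeCycle noNegative C with C′ , C′≈C ← unfold C = ≤-trans (noNegative C′) (≤-reflexive C′≈C)

    extend-potential : NoNegativeCycle G → ∀ {x} → Potential eliminate x → ∃ (Potential G)
    extend-potential noNegative {x} x-potential = y , y-potential
      where
      lows ups : List Carrier
      lows = gather (λ k w → x k - w) (λ k → G zero (suc k))
      ups  = gather (λ m w → x m + w) (λ m → G (suc m) zero)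

      low≤up : ∀ {l u} → l ∈ lows → u ∈ ups → l ≤ u
      low≤up l∈ u∈ with k , w₂ , w₂∈ , refl ← ∈-gather⁻ (λ k w → x k - w) _ l∈
                 with m , w₁ , w₁∈ , refl ← ∈-gather⁻ (λ m w → x m + w) _ u∈ =
        x≤y+z⇒x-z≤y (≤-trans (x-potential (∈-++⁺ʳ _ (∈-cartesianProductWith⁺ _+_ w₁∈ w₂∈)))
                             (≤-reflexive (≈-sym (+-assoc (x m) w₁ w₂))))

      -- Any value between the lower and the upper bounds will do; 0# only matters if there are no lower bounds.
      y₀ : Carrier
      y₀ = Extrema.min (Extrema.max 0# lows) ups

      low≤y₀ : ∀ {l} → l ∈ lows → l ≤ y₀
      low≤y₀ l∈ = Extrema.v≤min⁺ (Extrema.v≤max⁺ 0# lows (inj₂ (lose l∈ ≤-refl))) (All.tabulate (low≤up l∈))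

      y₀≤up : ∀ {u} → u ∈ ups → y₀ ≤ u
      y₀≤up u∈ = Extrema.min≤v⁺ _ ups (inj₂ (lose u∈ ≤-refl))

      y : Fin (suc N) → Carrier
      y zero    = y₀
      y (suc m) = x m

      y-potential : Potential G y
      y-potential {zero}  {zero}  {w} w∈ = begin
        y₀        ≈⟨ +-identityʳ y₀ ⟨
        y₀ + 0#   ≤⟨ +-monoʳ-≤ y₀ (≤-trans (noNegative ((w , w∈) ◅ ε)) (≤-reflexive (+-identityʳ w))) ⟩
        y₀ + w    ∎
        where open ≤-Reasoning
      y-potential {zero}  {suc k} w∈ = x-z≤y⇒x≤y+z (low≤y₀ (∈-gather⁺ (λ k w → x k - w) _ w∈))
      y-potential {suc m} {zero}  w∈ = y₀≤up (∈-gather⁺ (λ m w → x m + w) _ w∈)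
      y-potential {suc m} {suc k} w∈ = x-potential (∈-++⁺ˡ w∈)

  potential : ∀ {N} (G : Graph N) → NoNegativeCycle G → ∃ (Potential G)
  potential {zero}  G _ = (λ ()) , λ { {()} }
  potential {suc N} G noNegative
    with x , x-potential ← potential (eliminate G) (eliminate-noNegativeCycle G noNegative) =
    extend-potential G noNegative x-potential

  -- Balanced pairs of least cost and their exchange graphs

  module _ {n d} (v : Fin n → Fin d → Carrier) where

    total : (Fin n → Fin d) → Carrier
    total a = Σ n (λ i → v i (a i))

    cost : AssignmentPair n d → Carrier
    cost (a , b) = total a - total b

    total-cong : ∀ {a a′} → a ≗ a′ → total a ≈ total a′
    total-cong a≗a′ = Σ-cong n (λ i → ≈-reflexive (≡.cong (v i) (a≗a′ i)))

    total-updateAt : ∀ a i k → total (updateAt a i (const k)) + v i (a i) ≈ total a + v i k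
    total-updateAt a i k = ≈-trans
      (Σ-agreeing-off n _ _ i (λ i′ i′≢i → ≈-reflexive (≡.cong (v i′) (updateAt-minimal i′ i a i′≢i))))
      (+-congˡ (≈-reflexive (≡.cong (v i) (updateAt-updates i a))))

    cost-cong : ∀ {a a′ b b′} → a ≗ a′ → b ≗ b′ → cost (a , b) ≈ cost (a′ , b′)
    cost-cong a≗a′ b≗b′ = +-cong (total-cong a≗a′) (-‿cong (total-cong b≗b′))

    optimal-balanced-pair : Fin d → ∃₂ λ a b → Balanced a b ×
                                              (∀ a′ b′ → Balanced a′ b′ → cost (a , b) ≤ cost (a′ , b′))
    optimal-balanced-pair j₀ = proj₁ best , proj₂ best , best-balanced , best-optimal
      where
      all-pairs candidates : List (AssignmentPair n d)
      all-pairs  = cartesianProduct (allFunctions n d) (allFunctions n d)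
      candidates = filter balanced? all-pairs

      best : AssignmentPair n d
      best = Extrema.argmin cost (const j₀ , const j₀) candidates

      best-balanced : Balanced (proj₁ best) (proj₂ best)
      best-balanced = Extrema.argmin-all cost {const j₀ , const j₀} {candidates} (λ _ → refl)
                        (All.tabulate (λ s∈ → proj₂ (∈-filter⁻ balanced? {xs = all-pairs} s∈)))

      best-optimal : ∀ a′ b′ → Balanced a′ b′ → cost best ≤ cost (a′ , b′)
      best-optimal a′ b′ balanced′
        with a″ , a″∈ , a″≗a′ ← ∈-allFunctions a′ with b″ , b″∈ , b″≗b′ ← ∈-allFunctions b′ = begin
        cost best         ≤⟨ All.lookup (Extrema.f[argmin]≤f[xs] _ candidates) a″b″∈candidates ⟩
        cost (a″ , b″)    ≈⟨ cost-cong a″≗a′ b″≗b′ ⟩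
        cost (a′ , b′)    ∎
        where
        open ≤-Reasoning
        balanced″ : Balanced a″ b″
        balanced″ j = ≡.trans (count-cong a″≗a′ j) (≡.trans (balanced′ j) (≡.sym (count-cong b″≗b′ j)))
        a″b″∈candidates : (a″ , b″) ∈ candidates
        a″b″∈candidates = ∈-filter⁺ balanced? (∈-cartesianProduct⁺ a″∈ b″∈) balanced″

    module Exchange (a b : Fin n → Fin d) where

      -- Row i gives an edge m → k if a i ≡ m (move a i to k) or b i ≡ k (move b i to m); either
      -- move changes the cost by v i k - v i m.
      Step : Fin d → Fin d → Set
      Step m k = ∃ λ i → a i ≡ m ⊎ b i ≡ k

      stepWeight : ∀ {m k} → Step m k → Carrier
      stepWeight {m} {k} (i , _) = v i k - v i m

      Walk : Fin d → Fin d → Set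
      Walk = Star Step

      applyStep : ∀ {m k} → Step m k → AssignmentPair n d → AssignmentPair n d
      applyStep {m} {k} (i , inj₁ _) (a₀ , b₀) = updateAt a₀ i (const k) , b₀
      applyStep {m} {k} (i , inj₂ _) (a₀ , b₀) = a₀ , updateAt b₀ i (const m)

      apply : ∀ {m l} → Walk m l → AssignmentPair n d → AssignmentPair n d
      apply ε       s = s
      apply (e ◅ W) s = apply W (applyStep e s)

      FreshStep : ∀ {m k} → AssignmentPair n d → Step m k → Set
      FreshStep (a₀ , _) (i , inj₁ _) = a₀ i ≡ a i
      FreshStep (_ , b₀) (i , inj₂ _) = b₀ i ≡ b i

      Fresh : ∀ {m l} → AssignmentPair n d → Walk m l → Set
      Fresh s ε       = ⊤
      Fresh s (e ◅ W) = FreshStep s e × Fresh s W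

      fresh-initially : ∀ {m l} (W : Walk m l) → Fresh (a , b) W
      fresh-initially ε                  = tt
      fresh-initially ((_ , inj₁ _) ◅ W) = refl , fresh-initially W
      fresh-initially ((_ , inj₂ _) ◅ W) = refl , fresh-initially W

      AvoidsTail AvoidsHead : ∀ {k l} → Fin d → Walk k l → Set
      AvoidsTail u ε                 = ⊤
      AvoidsTail u (_◅_ {m} _ W)     = m ≢ u × AvoidsTail u W
      AvoidsHead u ε                 = ⊤
      AvoidsHead u (_◅_ {j = k} _ W) = k ≢ u × AvoidsHead u W

      -- Distinct tails and heads: no entry of a or b is moved twice, so the walk can be applied at once.
      Applicable : ∀ {m l} → Walk m l → Set
      Applicable ε                 = ⊤
      Applicable (_◅_ {m} {k} _ W) = AvoidsTail m W × AvoidsHead k W × Applicable W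

      applyStep-shifts : ∀ {m k} (e : Step m k) s → FreshStep s e → Shifted s (applyStep e s) m k
      applyStep-shifts (i , inj₁ refl) (a₀ , b₀) fresh = updateAt-shiftsˡ a₀ b₀ i _ fresh
      applyStep-shifts (i , inj₂ refl) (a₀ , b₀) fresh = updateAt-shiftsʳ a₀ b₀ i _ fresh

      applyStep-cost : ∀ {m k} (e : Step m k) s → FreshStep s e → cost (applyStep e s) ≈ cost s + stepWeight e
      applyStep-cost (i , inj₁ refl) (a₀ , b₀) fresh =
        x+y≈z+w⇒x-u≈[z-u]+[w-y] (total b₀) (≈-trans (+-congˡ (≈-reflexive (≡.cong (v i) (≡.sym fresh))))
                                                    (total-updateAt a₀ i _))
      applyStep-cost (i , inj₂ refl) (a₀ , b₀) fresh =
        x+y≈z+w⇒u-x≈[u-z]+[y-w] (total a₀) (≈-trans (+-congˡ (≈-reflexive (≡.cong (v i) (≡.sym fresh))))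
                                                    (total-updateAt b₀ i _))

      fresh-updateAtˡ : ∀ {a₀ b₀ i k u l} (W : Walk u l) → AvoidsTail (a i) W → Fresh (a₀ , b₀) W →
                        Fresh (updateAt a₀ i (const k) , b₀) W
      fresh-updateAtˡ ε _ _ = tt
      fresh-updateAtˡ {a₀} {i = i} ((i′ , inj₁ refl) ◅ W) (ai′≢ai , avoids) (fresh , fresh-W) =
        ≡.trans (updateAt-minimal i′ i a₀ (ai′≢ai ∘ ≡.cong a)) fresh , fresh-updateAtˡ W avoids fresh-W
      fresh-updateAtˡ ((_ , inj₂ _) ◅ W) (_ , avoids) (fresh , fresh-W) = fresh , fresh-updateAtˡ W avoids fresh-W

      fresh-updateAtʳ : ∀ {a₀ b₀ i m u l} (W : Walk u l) → AvoidsHead (b i) W → Fresh (a₀ , b₀) W →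
                        Fresh (a₀ , updateAt b₀ i (const m)) W
      fresh-updateAtʳ ε _ _ = tt
      fresh-updateAtʳ ((_ , inj₁ _) ◅ W) (_ , avoids) (fresh , fresh-W) = fresh , fresh-updateAtʳ W avoids fresh-W
      fresh-updateAtʳ {b₀ = b₀} {i} ((i′ , inj₂ refl) ◅ W) (bi′≢bi , avoids) (fresh , fresh-W) =
        ≡.trans (updateAt-minimal i′ i b₀ (bi′≢bi ∘ ≡.cong b)) fresh , fresh-updateAtʳ W avoids fresh-W

      applyStep-fresh : ∀ {m k l} (e : Step m k) s (W : Walk k l) → AvoidsTail m W → AvoidsHead k W →
                        Fresh s W → Fresh (applyStep e s) W
      applyStep-fresh (i , inj₁ refl) _ W avoids _ = fresh-updateAtˡ W avoids
      applyStep-fresh (i , inj₂ refl) _ W _ avoids = fresh-updateAtʳ W avoids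

      apply-cost-shift : ∀ {m l} (W : Walk m l) s → Fresh s W → Applicable W →
                         cost (apply W s) ≈ cost s + weight stepWeight W × Shifted s (apply W s) m l
      apply-cost-shift ε s _ _ = ≈-sym (+-identityʳ (cost s)) , Shifted-refl
      apply-cost-shift (e ◅ W) s (fresh-e , fresh-W) (avoidsT , avoidsH , applicable)
        with cost≈ , W-shifts ← apply-cost-shift W (applyStep e s)
                                  (applyStep-fresh e s W avoidsT avoidsH fresh-W) applicable =
        ≈-trans cost≈ (≈-trans (+-congʳ (applyStep-cost e s fresh-e)) (+-assoc _ _ _)) ,
        Shifted-trans (applyStep-shifts e s fresh-e) W-shifts

      split-at-tail : ∀ u {k l} (W : Walk k l) →
                      AvoidsTail u W ⊎ ∃₂ λ (W₁ : Walk k u) (W₂ : Walk u l) → 0 ℕ.< length W₂ × W ≡ W₁ ◅◅ W₂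
      split-at-tail u ε = inj₁ tt
      split-at-tail u (_◅_ {m} e W) with m ≟ u
      ... | yes refl = inj₂ (ε , e ◅ W , s≤s z≤n , refl)
      ... | no m≢u with split-at-tail u W
      ...   | inj₁ avoids                   = inj₁ (m≢u , avoids)
      ...   | inj₂ (W₁ , W₂ , 0<W₂ , refl) = inj₂ (e ◅ W₁ , W₂ , 0<W₂ , refl)

      split-at-head : ∀ u {k l} (W : Walk k l) →
                      AvoidsHead u W ⊎ ∃₂ λ (W₁ : Walk k u) (W₂ : Walk u l) → 0 ℕ.< length W₁ × W ≡ W₁ ◅◅ W₂
      split-at-head u ε = inj₁ tt
      split-at-head u (_◅_ {j = k} e W) with k ≟ u
      ... | yes refl = inj₂ (e ◅ ε , W , s≤s z≤n , refl)
      ... | no k≢u with split-at-head u W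
      ...   | inj₁ avoids                 = inj₁ (k≢u , avoids)
      ...   | inj₂ (W₁ , W₂ , _ , refl) = inj₂ (e ◅ W₁ , W₂ , s≤s z≤n , refl)

      record Detour {m l} (W : Walk m l) : Set where
        constructor detour
        field
          u      : Fin d
          before : Walk m u
          loop   : Walk u u
          after  : Walk u l
          loop-nonEmpty : 0 ℕ.< length loop
          rest-nonEmpty : 0 ℕ.< length before ℕ.+ length after
          splits : W ≡ before ◅◅ loop ◅◅ after

      applicable-or-detour : ∀ {m l} (W : Walk m l) → Applicable W ⊎ Detour W
      applicable-or-detour ε = inj₁ tt
      applicable-or-detour (_◅_ {m} {k} e W) with split-at-tail m W
      ... | inj₂ (W₁ , W₂ , 0<W₂ , refl) = inj₂ (detour m ε (e ◅ W₁) W₂ (s≤s z≤n) 0<W₂ refl)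
      ... | inj₁ avoidsT with split-at-head k W
      ...   | inj₂ (W₁ , W₂ , 0<W₁ , refl) = inj₂ (detour k (e ◅ ε) W₁ W₂ 0<W₁ (s≤s z≤n) refl)
      ...   | inj₁ avoidsH with applicable-or-detour W
      ...     | inj₁ applicable = inj₁ (avoidsT , avoidsH , applicable)
      ...     | inj₂ (detour u W₁ L W₃ 0<L _ refl) = inj₂ (detour u (e ◅ W₁) L W₃ 0<L (s≤s z≤n) refl)

      exchangeGraph : Graph d
      exchangeGraph m k = map (λ i → v i k - v i m) (filter (λ i → a i ≟ m ⊎-dec b i ≟ k) (allFin n))

      ∈-exchangeGraph : ∀ i {m k} → a i ≡ m ⊎ b i ≡ k → v i k - v i m ∈ exchangeGraph m k
      ∈-exchangeGraph i step = ∈-map⁺ _ (∈-filter⁺ (λ i → a i ≟ _ ⊎-dec b i ≟ _) (∈-allFin i) step)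

      toWalk : ∀ {m l} (W : Star (Edge exchangeGraph) m l) →
               ∃ λ (W′ : Walk m l) → weight stepWeight W′ ≈ weight proj₁ W
      toWalk ε = ε , ≈-refl
      toWalk (_◅_ {m} {k} (w , w∈) W) with i , i∈ , refl ← ∈-map⁻ (λ i → v i k - v i m) w∈
                                      with W′ , W′≈W ← toWalk W =
        (i , proj₂ (∈-filter⁻ (λ i → a i ≟ m ⊎-dec b i ≟ k) {xs = allFin n} i∈)) ◅ W′ , +-congˡ W′≈W

      module _ (balanced : Balanced a b)
               (optimal : ∀ a′ b′ → Balanced a′ b′ → cost (a , b) ≤ cost (a′ , b′)) where

        applicable-cycle-nonNegative : ∀ {m} (C : Walk m m) → Applicable C → 0# ≤ weight stepWeight C
        applicable-cycle-nonNegative C applicable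
          with cost≈ , C-shifts ← apply-cost-shift C (a , b) (fresh-initially C) applicable =
          x≤x+y⇒0≤y (≤-trans (optimal _ _ (Shifted-balanced C-shifts balanced)) (≤-reflexive cost≈))

        cycle-nonNegative : ∀ {m} (C : Walk m m) → 0# ≤ weight stepWeight C
        cycle-nonNegative C = go C (<-wellFounded (length C))
          where
          go : ∀ {m} (C : Walk m m) → Acc ℕ._<_ (length C) → 0# ≤ weight stepWeight C
          go C (acc shorter) with applicable-or-detour C
          ... | inj₁ applicable = applicable-cycle-nonNegative C applicable
          ... | inj₂ (detour _ W₁ L W₃ 0<L 0<W₁W₃ refl)
            with L<C , W₁W₃<C ← detour-shorter W₁ L W₃ 0<L 0<W₁W₃ = begin
            0#                                      ≈⟨ +-identityʳ 0# ⟨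
            0# + 0#                                 ≤⟨ +-mono-≤ (go L (shorter L<C)) (go (W₁ ◅◅ W₃) (shorter W₁W₃<C)) ⟩
            weight stepWeight L + weight stepWeight (W₁ ◅◅ W₃)  ≈⟨ weight-detour stepWeight W₁ L W₃ ⟨
            weight stepWeight (W₁ ◅◅ L ◅◅ W₃)       ∎
            where open ≤-Reasoning

        exchangeGraph-noNegativeCycle : NoNegativeCycle exchangeGraph
        exchangeGraph-noNegativeCycle C with C′ , C′≈C ← toWalk C =
          ≤-trans (cycle-nonNegative C′) (≤-reflexive C′≈C)

        dual-certificate : ∃ λ (x : Fin d → Carrier) → (∀ i k → v i (a i) - x (a i) ≤ v i k - x k) ×
                                                        (∀ i k → v i k - x k ≤ v i (b i) - x (b i))
        dual-certificate with x , x-potential ← potential exchangeGraph exchangeGraph-noNegativeCycle =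
          x , (λ i k → y≤x+[p-q]⇒q-x≤p-y (x-potential (∈-exchangeGraph i (inj₁ refl))))
            , (λ i k → y≤x+[p-q]⇒q-x≤p-y (x-potential (∈-exchangeGraph i (inj₂ refl))))

lemma3 : ∀ {c ℓ₁ ℓ₂} (F : OrderedField c ℓ₁ ℓ₂) (n d : ℕ) → 1 ℕ.≤ d →
         (v : Fin n → Fin d → OrderedField.Carrier F) →
         ∃₂ λ π φ → DualLP.ZeroOne F n d v π × DualLP.ZeroOne F n d v φ ×
                    DualLP.Optimal F n d v π φ
lemma3 F n (suc d) _ v
  with a , b , balanced , optimal ← optimal-balanced-pair F v zero
  with x , a-minimises , b-maximises ← Exchange.dual-certificate F v a b balanced optimal =
  π⟨_⟩ F a , φ⟨_⟩ F b , (λ i j → 𝟙≈0⊎𝟙≈1 F (a i) j) , (λ j i → 𝟙≈0⊎𝟙≈1 F (b i) j) ,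
  ⟨⟩-optimal F v x balanced a-minimises b-maximises
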